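{- Let $p_2>3$ be a prime, let $p_3>3p_2$ be a prime with $p_3\equiv 2\pmod{3p_2}$, and let $q=\lfloor p_3/(3p_2)\rfloor$. Then for every integer $i\ge p_2$, $\mathrm{hw}(f_{3p_2,p_3,i,q})=0$, i.e. $f_{3p_2,p_3,i,q}=0$.
   Context: $\Phi_n$ is the $n$-th cyclotomic polynomial; $\mathrm{hw}(f)$ is the number of nonzero coefficients of a polynomial $f$. With $m=3p_2$, write $\Phi_{mp_3}(x)=\sum_{i\ge0}f_{m,p_3,i}(x)x^{ip_3}$ with $\deg f_{m,p_3,i}<p_3$, and $f_{m,p_3,i}(x)=\sum_{j\ge0}f_{m,p_3,i,j}(x)x^{jm}$ with $\deg f_{m,p_3,i,j}<m$ (uniquely determined). -}

module Defs where

open import Data.Nat as ℕ using (ℕ; zero; suc; _<?_; _≟_)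
open import Data.Nat.Divisibility using (_∣?_)
open import Data.Integer as ℤ using (ℤ; +_; -_)
open import Data.List using (List; map; foldr; filter; upTo)
open import Relation.Nullary.Decidable using (does)
open import Data.Bool using (if_then_else_)

-- Formal power series with integer coefficients: coefficient functions ℕ → ℤ.
-- (Polynomials in ℤ[x] embed into these.)
Series : Set
Series = ℕ → ℤ

mulS : Series → Series → Series
mulS f g k = foldr (λ i acc → f i ℤ.* g (k ℕ.∸ i) ℤ.+ acc) (+ 0) (upTo (suc k))

oneS : Series
oneS zero = + 1
oneS (suc _) = + 0

prodS : List Series → Series
prodS = foldr mulS oneS

divisors : ℕ → List ℕ
divisors n = filter (λ d → d ∣? n) (upTo (suc n))

xPowMinusOne : ℕ → Series
xPowMinusOne n k =
  if does (k ≟ n) then + 1 else (if does (k ≟ 0) then - (+ 1) else + 0)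

-- Φ is the family of cyclotomic polynomials: x^n - 1 = ∏_{d ∣ n} Φ_d for all n ≥ 1.
-- This determines Φ_n uniquely (even in ℤ[[x]]), by strong induction on n.
IsCyclotomicFamily : (ℕ → Series) → Set
IsCyclotomicFamily Φ =
  (n : ℕ) → 1 ℕ.≤ n → (k : ℕ) → prodS (map Φ (divisors n)) k ≡ xPowMinusOne n k
  where open import Relation.Binary.PropositionalEquality using (_≡_)

-- f_{m,p,i}: coefficients of Φ_{mp} at positions ip, …, ip+p-1
fBlock : (ℕ → Series) → ℕ → ℕ → ℕ → Series
fBlock Φ m p i k = if does (k <? p) then Φ (m ℕ.* p) (i ℕ.* p ℕ.+ k) else + 0

-- f_{m,p,i,j}: coefficients of f_{m,p,i} at positions jm, …, jm+m-1
fSubBlock : (ℕ → Series) → ℕ → ℕ → ℕ → ℕ → Series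
fSubBlock Φ m p i j l = if does (l <? m) then fBlock Φ m p i (j ℕ.* m ℕ.+ l) else + 0

-- floor division and remainder (used only with nonzero divisor)
divℕ : ℕ → ℕ → ℕ
divℕ a zero = 0
divℕ a (suc n) = a ℕ./ suc n

modℕ : ℕ → ℕ → ℕ
modℕ a zero = a
modℕ a (suc n) = a ℕ.% suc n

-- Let m = 3p and 1/Φₘ = (1 + x + x²)(xᵖ − 1)/(x³ᵖ − 1), a power series of period 3p.
-- From xⁿ − 1 = ∏_{d ∣ n} Φ_d one gets Φₘᵣ(x) = Φₘ(xʳ) · (1/Φₘ)(x) for every prime r > m,
-- so the coefficient of x^(ir + jm + l) in Φₘᵣ is Σₐ [xᵃ]Φₘ · [x^(ir + jm + l − ar)](1/Φₘ).
-- For r = qm + 2, j = q and l ≤ 1, periodicity lets r be replaced by 2: this is the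
-- coefficient of x^(2i + l) in Φₘ(x²)/Φₘ(x) = Φ₆(xᵖ)/Φ₆(x) = Φ₆ₚ, which vanishes since
-- 2i + l ≥ 2p exceeds its degree 2p − 2 (seen through 1/Φ₆ = (1 + x)/(1 + x³) and p ≡ ±1 mod 6).
-- For l ≥ 2 the exponent jm + l is at least r, outside the block.
module Submission where

open import Defs
open import Data.Nat as ℕ
  using (ℕ; zero; suc; _+_; _*_; _∸_; _≤_; _<_; z≤n; s≤s; _≟_; _<?_; _≤?_; NonZero)
import Data.Nat.Properties as ℕ
open import Data.Integer as ℤ using (ℤ; +_; -_)
import Data.Integer.Properties as ℤ
open import Data.Integer.Tactic.RingSolver using (solve-∀)
import Data.Nat.Tactic.RingSolver as ℕ-Ring
open import Data.List using (List; []; _∷_; _++_; foldr; map; filter; upTo; applyUpTo)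
open import Data.List.Properties using (upTo-∷ʳ; filter-++; filter-accept; filter-reject; ++-assoc; ++-identityʳ)
open import Data.List.Relation.Unary.All as All using (All; []; _∷_)
open import Data.List.Relation.Unary.All.Properties using (++⁺; map⁺)
open import Data.List.Relation.Unary.Any using (here; there)
open import Data.List.Membership.Propositional using (_∈_)
open import Data.List.Membership.Propositional.Properties using (∈-++⁺ˡ; ∈-++⁺ʳ; ∈-map⁺)
open import Data.Nat.Divisibility
  using ( _∣_; _∣?_; divides; ∣-refl; ∣-trans; ∣⇒≤; ∣1⇒≡1; 1∣_; m∣m*n; n∣m*n
        ; *-monoˡ-∣; *-cancelʳ-∣; ∣m+n∣m⇒∣n; ∣m∸n∣n⇒∣m)
open import Data.Nat.Divisibility.Core using (hasNonTrivialDivisor)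
open import Data.Nat.DivMod using (_/_; _%_; m≡m%n+[m/n]*n; m%n<n; m/n*n≤m)
open import Data.Nat.Primality
  using (Prime; prime?; prime⇒irreducible; prime⇒nonZero; prime⇒nonTrivial; prime⇒¬composite)
open import Data.Nat.Coprimality using (Coprime; coprime-divisor)
open import Data.Sum using (_⊎_; inj₁; inj₂)
open import Data.Unit using (⊤; tt)
open import Function using (_∘_; id)
open import Level using (0ℓ)
open import Algebra.Bundles using (CommutativeMonoid)
open import Data.Product using (_×_; _,_; ∃-syntax)
open import Data.Bool using (true; false; if_then_else_)
open import Data.Nat.Induction using (<-rec)
open import Relation.Nullary using (¬_; Dec; yes; no; contradiction)
open import Relation.Nullary.Decidable using (does; dec-true; dec-false; from-yes)
open import Algebra.Properties.AbelianGroup ℤ.+-0-abelianGroup using (∙-cancelˡ)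
open import Relation.Binary.PropositionalEquality using (_≡_; refl; sym; trans; cong; cong₂; subst; module ≡-Reasoning)
import Relation.Binary.Reasoning.Setoid as SetoidReasoning

∑ : ℕ → (ℕ → ℤ) → ℤ
∑ zero    F = + 0
∑ (suc n) F = F 0 ℤ.+ ∑ n (F ∘ suc)

∑-cong : ∀ n {F G : ℕ → ℤ} → (∀ j → j < n → F j ≡ G j) → ∑ n F ≡ ∑ n G
∑-cong zero    eq = refl
∑-cong (suc n) eq = cong₂ ℤ._+_ (eq 0 (s≤s z≤n)) (∑-cong n (λ j j<n → eq (suc j) (s≤s j<n)))

∑-cong′ : ∀ n {F G : ℕ → ℤ} → (∀ j → F j ≡ G j) → ∑ n F ≡ ∑ n G
∑-cong′ n eq = ∑-cong n (λ j _ → eq j)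

∑-zero : ∀ n {F : ℕ → ℤ} → (∀ j → j < n → F j ≡ + 0) → ∑ n F ≡ + 0
∑-zero zero    vanish = refl
∑-zero (suc n) vanish = cong₂ ℤ._+_ (vanish 0 (s≤s z≤n)) (∑-zero n (λ j j<n → vanish (suc j) (s≤s j<n)))

∑-+ : ∀ n (F G : ℕ → ℤ) → ∑ n (λ j → F j ℤ.+ G j) ≡ ∑ n F ℤ.+ ∑ n G
∑-+ zero    F G = refl
∑-+ (suc n) F G = trans (cong (λ z → F 0 ℤ.+ G 0 ℤ.+ z) (∑-+ n (F ∘ suc) (G ∘ suc)))
                        (interchange (F 0) (G 0) (∑ n (F ∘ suc)) (∑ n (G ∘ suc)))
  where
  interchange : ∀ a b c d → (a ℤ.+ b) ℤ.+ (c ℤ.+ d) ≡ (a ℤ.+ c) ℤ.+ (b ℤ.+ d)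
  interchange = solve-∀

∑-*ˡ : ∀ n c (F : ℕ → ℤ) → ∑ n (λ j → c ℤ.* F j) ≡ c ℤ.* ∑ n F
∑-*ˡ zero    c F = sym (ℤ.*-zeroʳ c)
∑-*ˡ (suc n) c F = trans (cong (λ z → c ℤ.* F 0 ℤ.+ z) (∑-*ˡ n c (F ∘ suc)))
                         (sym (ℤ.*-distribˡ-+ c (F 0) (∑ n (F ∘ suc))))

∑-*ʳ : ∀ n c (F : ℕ → ℤ) → ∑ n (λ j → F j ℤ.* c) ≡ ∑ n F ℤ.* c
∑-*ʳ n c F = trans (∑-cong′ n (λ j → ℤ.*-comm (F j) c))
                   (trans (∑-*ˡ n c F) (ℤ.*-comm c (∑ n F)))

∑-split : ∀ m n (F : ℕ → ℤ) → ∑ (m + n) F ≡ ∑ m F ℤ.+ ∑ n (λ j → F (m + j))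
∑-split zero    n F = sym (ℤ.+-identityˡ _)
∑-split (suc m) n F = trans (cong (λ z → F 0 ℤ.+ z) (∑-split m n (F ∘ suc))) (sym (ℤ.+-assoc (F 0) _ _))

∑-snoc : ∀ n (F : ℕ → ℤ) → ∑ (suc n) F ≡ ∑ n F ℤ.+ F n
∑-snoc n F = begin
  ∑ (suc n) F                                   ≡⟨ cong (λ k → ∑ k F) (ℕ.+-comm 1 n) ⟩
  ∑ (n + 1) F                                   ≡⟨ ∑-split n 1 F ⟩
  ∑ n F ℤ.+ (F (n + 0) ℤ.+ + 0)                 ≡⟨ cong (λ z → ∑ n F ℤ.+ z) (ℤ.+-identityʳ _) ⟩
  ∑ n F ℤ.+ F (n + 0)                           ≡⟨ cong (λ k → ∑ n F ℤ.+ F k) (ℕ.+-identityʳ n) ⟩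
  ∑ n F ℤ.+ F n                                 ∎
  where open ≡-Reasoning

∑-truncate : ∀ {n m} (G : ℕ → ℤ) → n ≤ m → (∀ j → n ≤ j → j < m → G j ≡ + 0) → ∑ m G ≡ ∑ n G
∑-truncate {n} {m} G n≤m vanish = begin
  ∑ m G                                          ≡⟨ cong (λ k → ∑ k G) (sym (ℕ.m+[n∸m]≡n n≤m)) ⟩
  ∑ (n + (m ∸ n)) G                              ≡⟨ ∑-split n (m ∸ n) G ⟩
  ∑ n G ℤ.+ ∑ (m ∸ n) (λ j → G (n + j))          ≡⟨ cong (λ z → ∑ n G ℤ.+ z) (∑-zero (m ∸ n) tail-vanishes) ⟩
  ∑ n G ℤ.+ + 0                                  ≡⟨ ℤ.+-identityʳ _ ⟩
  ∑ n G                                          ∎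
  where
  open ≡-Reasoning
  tail-vanishes : ∀ j → j < m ∸ n → G (n + j) ≡ + 0
  tail-vanishes j j< = vanish (n + j) (ℕ.m≤m+n n j)
    (subst (n + j <_) (ℕ.m+[n∸m]≡n n≤m) (ℕ.+-monoʳ-< n j<))

∑-reverse : ∀ n (F : ℕ → ℤ) → ∑ n F ≡ ∑ n (λ j → F (n ∸ suc j))
∑-reverse zero    F = refl
∑-reverse (suc n) F = begin
  ∑ (suc n) F                                   ≡⟨ ∑-snoc n F ⟩
  ∑ n F ℤ.+ F n                                 ≡⟨ cong (λ z → z ℤ.+ F n) (∑-reverse n F) ⟩
  ∑ n (λ j → F (n ∸ suc j)) ℤ.+ F n             ≡⟨ ℤ.+-comm _ (F n) ⟩
  ∑ (suc n) (λ j → F (suc n ∸ suc j))           ∎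
  where open ≡-Reasoning

∑-triangle : ∀ n (T : ℕ → ℕ → ℤ) →
  ∑ (suc n) (λ i → ∑ (suc i) (T i)) ≡ ∑ (suc n) (λ j → ∑ (suc n ∸ j) (λ s → T (j + s) j))
∑-triangle zero    T = refl
∑-triangle (suc n) T = sym (begin
  ∑ (suc (suc n)) (λ j → ∑ (suc (suc n) ∸ j) (λ s → T (j + s) j))
    ≡⟨ ∑-cong (suc (suc n)) peel-last-row ⟩
  ∑ (suc (suc n)) (λ j → column j ℤ.+ T (suc n) j)
    ≡⟨ ∑-+ (suc (suc n)) column (T (suc n)) ⟩
  ∑ (suc (suc n)) column ℤ.+ ∑ (suc (suc n)) (T (suc n))
    ≡⟨ cong (λ z → z ℤ.+ ∑ (suc (suc n)) (T (suc n))) drop-empty-column ⟩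
  ∑ (suc n) (λ i → ∑ (suc i) (T i)) ℤ.+ ∑ (suc (suc n)) (T (suc n))
    ≡⟨ sym (∑-snoc (suc n) (λ i → ∑ (suc i) (T i))) ⟩
  ∑ (suc (suc n)) (λ i → ∑ (suc i) (T i)) ∎)
  where
  open ≡-Reasoning
  column : ℕ → ℤ
  column j = ∑ (suc n ∸ j) (λ s → T (j + s) j)
  peel-last-row : ∀ j → j < suc (suc n) →
    ∑ (suc (suc n) ∸ j) (λ s → T (j + s) j) ≡ column j ℤ.+ T (suc n) j
  peel-last-row j (s≤s j≤) rewrite ℕ.+-∸-assoc 1 j≤ =
    trans (∑-snoc (suc n ∸ j) (λ s → T (j + s) j))
          (cong (λ i → column j ℤ.+ T i j) (ℕ.m+[n∸m]≡n j≤))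
  empty-column : column (suc n) ≡ + 0
  empty-column = cong (λ k → ∑ k (λ s → T (suc n + s) (suc n))) (ℕ.n∸n≡0 n)
  drop-empty-column : ∑ (suc (suc n)) column ≡ ∑ (suc n) (λ i → ∑ (suc i) (T i))
  drop-empty-column = begin
    ∑ (suc (suc n)) column                      ≡⟨ ∑-snoc (suc n) column ⟩
    ∑ (suc n) column ℤ.+ column (suc n)           ≡⟨ cong (λ z → ∑ (suc n) column ℤ.+ z) empty-column ⟩
    ∑ (suc n) column ℤ.+ + 0                    ≡⟨ ℤ.+-identityʳ _ ⟩
    ∑ (suc n) column                            ≡⟨ sym (∑-triangle n T) ⟩
    ∑ (suc n) (λ i → ∑ (suc i) (T i))         ∎

infix  4 _≈_
infixl 7 _·_

record _≈_ (f g : Series) : Set where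
  field coeff : ∀ k → f k ≡ g k

open _≈_ public

≈-refl : ∀ {f} → f ≈ f
≈-refl .coeff _ = refl

≈-sym : ∀ {f g} → f ≈ g → g ≈ f
≈-sym f≈g .coeff k = sym (f≈g .coeff k)

≈-trans : ∀ {f g h} → f ≈ g → g ≈ h → f ≈ h
≈-trans f≈g g≈h .coeff k = trans (f≈g .coeff k) (g≈h .coeff k)

-- Opaque, so that conversion checking compares products syntactically
-- instead of unfolding the convolution (which makes the monoid solver blow up).
opaque
  _·_ : Series → Series → Series
  _·_ = mulS

  ·-coeff : ∀ f g k → (f · g) k ≡ ∑ (suc k) (λ j → f j ℤ.* g (k ∸ j))
  ·-coeff f g k = foldr-upTo (suc k) (λ j → f j ℤ.* g (k ∸ j)) id
    where
    foldr-upTo : ∀ n (F : ℕ → ℤ) (h : ℕ → ℕ) →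
      foldr (λ i acc → F i ℤ.+ acc) (+ 0) (applyUpTo h n) ≡ ∑ n (F ∘ h)
    foldr-upTo zero    F h = refl
    foldr-upTo (suc n) F h = cong (λ z → F (h 0) ℤ.+ z) (foldr-upTo n F (h ∘ suc))

·-cong : ∀ {f f′ g g′} → f ≈ f′ → g ≈ g′ → f · g ≈ f′ · g′
·-cong {f} {f′} {g} {g′} f≈f′ g≈g′ .coeff k = begin
  (f · g) k                                ≡⟨ ·-coeff f g k ⟩
  ∑ (suc k) (λ j → f j ℤ.* g (k ∸ j))      ≡⟨ ∑-cong′ (suc k) (λ j → cong₂ ℤ._*_ (f≈f′ .coeff j) (g≈g′ .coeff (k ∸ j))) ⟩
  ∑ (suc k) (λ j → f′ j ℤ.* g′ (k ∸ j))    ≡⟨ sym (·-coeff f′ g′ k) ⟩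
  (f′ · g′) k                              ∎
  where open ≡-Reasoning

·-comm : ∀ f g → f · g ≈ g · f
·-comm f g .coeff k = begin
  (f · g) k                                        ≡⟨ ·-coeff f g k ⟩
  ∑ (suc k) (λ j → f j ℤ.* g (k ∸ j))              ≡⟨ ∑-reverse (suc k) (λ j → f j ℤ.* g (k ∸ j))⟩
  ∑ (suc k) (λ j → f (k ∸ j) ℤ.* g (k ∸ (k ∸ j)))  ≡⟨ ∑-cong (suc k) swap ⟩
  ∑ (suc k) (λ j → g j ℤ.* f (k ∸ j))              ≡⟨ sym (·-coeff g f k) ⟩
  (g · f) k                                        ∎
  where
  open ≡-Reasoning
  swap : ∀ j → j < suc k → f (k ∸ j) ℤ.* g (k ∸ (k ∸ j)) ≡ g j ℤ.* f (k ∸ j)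
  swap j (s≤s j≤k) = trans (cong (λ i → f (k ∸ j) ℤ.* g i) (ℕ.m∸[m∸n]≡n j≤k)) (ℤ.*-comm (f (k ∸ j)) (g j))

·-identityˡ : ∀ f → oneS · f ≈ f
·-identityˡ f .coeff k = begin
  (oneS · f) k                                     ≡⟨ ·-coeff oneS f k ⟩
  + 1 ℤ.* f k ℤ.+ ∑ k (λ j → + 0 ℤ.* f (k ∸ suc j)) ≡⟨ cong₂ ℤ._+_ (ℤ.*-identityˡ (f k)) (∑-zero k (λ _ _ → refl)) ⟩
  f k ℤ.+ + 0                                      ≡⟨ ℤ.+-identityʳ _ ⟩
  f k                                              ∎
  where open ≡-Reasoning

·-identityʳ : ∀ f → f · oneS ≈ f
·-identityʳ f .coeff k = trans (·-comm f oneS .coeff k) (·-identityˡ f .coeff k)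

·-assoc : ∀ f g h → (f · g) · h ≈ f · (g · h)
·-assoc f g h .coeff k = begin
  ((f · g) · h) k
    ≡⟨ ·-coeff (f · g) h k ⟩
  ∑ (suc k) (λ i → (f · g) i ℤ.* h (k ∸ i))
    ≡⟨ ∑-cong′ (suc k) expand-left ⟩
  ∑ (suc k) (λ i → ∑ (suc i) (λ j → f j ℤ.* g (i ∸ j) ℤ.* h (k ∸ i)))
    ≡⟨ ∑-triangle k (λ i j → f j ℤ.* g (i ∸ j) ℤ.* h (k ∸ i)) ⟩
  ∑ (suc k) (λ j → ∑ (suc k ∸ j) (λ s → f j ℤ.* g (j + s ∸ j) ℤ.* h (k ∸ (j + s))))
    ≡⟨ ∑-cong (suc k) collapse-right ⟩
  ∑ (suc k) (λ j → f j ℤ.* (g · h) (k ∸ j))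
    ≡⟨ sym (·-coeff f (g · h) k) ⟩
  (f · (g · h)) k ∎
  where
  open ≡-Reasoning
  expand-left : ∀ i → (f · g) i ℤ.* h (k ∸ i) ≡ ∑ (suc i) (λ j → f j ℤ.* g (i ∸ j) ℤ.* h (k ∸ i))
  expand-left i = trans (cong (λ z → z ℤ.* h (k ∸ i)) (·-coeff f g i))
                        (sym (∑-*ʳ (suc i) (h (k ∸ i)) (λ j → f j ℤ.* g (i ∸ j))))
  collapse-right : ∀ j → j < suc k →
    ∑ (suc k ∸ j) (λ s → f j ℤ.* g (j + s ∸ j) ℤ.* h (k ∸ (j + s))) ≡ f j ℤ.* (g · h) (k ∸ j)
  collapse-right j (s≤s j≤k) rewrite ℕ.+-∸-assoc 1 j≤k = begin
    ∑ (suc (k ∸ j)) (λ s → f j ℤ.* g (j + s ∸ j) ℤ.* h (k ∸ (j + s)))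
      ≡⟨ ∑-cong′ (suc (k ∸ j)) reindex ⟩
    ∑ (suc (k ∸ j)) (λ s → f j ℤ.* (g s ℤ.* h (k ∸ j ∸ s)))
      ≡⟨ ∑-*ˡ (suc (k ∸ j)) (f j) (λ s → g s ℤ.* h (k ∸ j ∸ s)) ⟩
    f j ℤ.* ∑ (suc (k ∸ j)) (λ s → g s ℤ.* h (k ∸ j ∸ s))
      ≡⟨ cong (f j ℤ.*_) (sym (·-coeff g h (k ∸ j))) ⟩
    f j ℤ.* (g · h) (k ∸ j) ∎
    where
    reindex : ∀ s → f j ℤ.* g (j + s ∸ j) ℤ.* h (k ∸ (j + s)) ≡ f j ℤ.* (g s ℤ.* h (k ∸ j ∸ s))
    reindex s = trans (ℤ.*-assoc (f j) _ _)
      (cong₂ (λ a b → f j ℤ.* (g a ℤ.* h b)) (ℕ.m+n∸m≡n j s) (sym (ℕ.∸-+-assoc k j s)))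

seriesMonoid : CommutativeMonoid 0ℓ 0ℓ
seriesMonoid = record
  { Carrier = Series
  ; _≈_     = _≈_
  ; _∙_     = _·_
  ; ε       = oneS
  ; isCommutativeMonoid = record
    { isMonoid = record
      { isSemigroup = record
        { isMagma = record
          { isEquivalence = record { refl = ≈-refl ; sym = ≈-sym ; trans = ≈-trans }
          ; ∙-cong = ·-cong }
        ; assoc = ·-assoc }
      ; identity = ·-identityˡ , ·-identityʳ }
    ; comm = ·-comm }
  }

module ≈-Reasoning = SetoidReasoning (CommutativeMonoid.setoid seriesMonoid)
open import Algebra.Solver.CommutativeMonoid seriesMonoid using (solve; _⊜_; _⊕_) renaming (id to ι)

∏ : List Series → Series
∏ = foldr _·_ oneS

opaque
  unfolding _·_

  prodS≡∏ : ∀ fs → prodS fs ≡ ∏ fs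
  prodS≡∏ fs = refl

x^_−1 : ℕ → Series
x^_−1 = xPowMinusOne

x^−1-cong : ∀ {a b} → a ≡ b → x^ a −1 ≈ x^ b −1
x^−1-cong a≡b .coeff t = cong (λ n → x^ n −1 t) a≡b

shift : ℕ → Series → Series
shift k f t = if does (k ≤? t) then f (t ∸ k) else + 0

shift-≥ : ∀ {k t} f → k ≤ t → shift k f t ≡ f (t ∸ k)
shift-≥ {k} {t} f k≤t rewrite dec-true (k ≤? t) k≤t = refl

shift-< : ∀ {k t} f → t < k → shift k f t ≡ + 0
shift-< {k} {t} f t<k rewrite dec-false (k ≤? t) (ℕ.<⇒≱ t<k) = refl

∑-indicator : ∀ n a (F : ℕ → ℤ) →
  ∑ n (λ j → (if does (j ≟ a) then + 1 else + 0) ℤ.* F j) ≡ (if does (a <? n) then F a else + 0)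
∑-indicator zero    a       F = refl
∑-indicator (suc n) zero    F = trans (cong₂ ℤ._+_ (ℤ.*-identityˡ (F 0)) (∑-zero n (λ _ _ → refl)))
                                      (ℤ.+-identityʳ (F 0))
∑-indicator (suc n) (suc a) F = trans (ℤ.+-identityˡ _) (∑-indicator n a (F ∘ suc))

x^−1-·-coeff : ∀ {k} → 1 ≤ k → ∀ f t → (x^ k −1 · f) t ≡ shift k f t ℤ.- f t
x^−1-·-coeff {suc k} _ f t = begin
  (x^ suc k −1 · f) t
    ≡⟨ ·-coeff (x^ suc k −1) f t ⟩
  - + 1 ℤ.* f t ℤ.+ ∑ t (λ j → (if does (j ≟ k) then + 1 else + 0) ℤ.* f (t ∸ suc j))
    ≡⟨ cong₂ ℤ._+_ (ℤ.-1*i≡-i (f t)) (∑-indicator t k (λ j → f (t ∸ suc j))) ⟩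
  - f t ℤ.+ shift (suc k) f t
    ≡⟨ ℤ.+-comm (- f t) _ ⟩
  shift (suc k) f t ℤ.- f t ∎
  where open ≡-Reasoning

·-x^−1-coeff : ∀ {k} → 1 ≤ k → ∀ f t → (f · x^ k −1) t ≡ shift k f t ℤ.- f t
·-x^−1-coeff 1≤k f t = trans (·-comm f (x^ _ −1) .coeff t) (x^−1-·-coeff 1≤k f t)

x^−1-cancelˡ : ∀ {k} → 1 ≤ k → ∀ {A B} → x^ k −1 · A ≈ x^ k −1 · B → A ≈ B
x^−1-cancelˡ {k} 1≤k {A} {B} eq .coeff = <-rec (λ t → A t ≡ B t) step
  where
  coeff-eq : ∀ t → shift k A t ℤ.- A t ≡ shift k B t ℤ.- B t
  coeff-eq t = trans (sym (x^−1-·-coeff 1≤k A t)) (trans (eq .coeff t) (x^−1-·-coeff 1≤k B t))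
  step : ∀ t → (∀ {s} → s < t → A s ≡ B s) → A t ≡ B t
  step t ih with k ≤? t
  ... | yes k≤t = ℤ.neg-injective (∙-cancelˡ (B (t ∸ k)) (- A t) (- B t) (begin
        B (t ∸ k) ℤ.- A t      ≡⟨ cong (λ z → z ℤ.- A t) (sym (ih (ℕ.∸-monoʳ-< 1≤k k≤t))) ⟩
        A (t ∸ k) ℤ.- A t      ≡⟨ cong (λ z → z ℤ.- A t) (sym (shift-≥ A k≤t)) ⟩
        shift k A t ℤ.- A t    ≡⟨ coeff-eq t ⟩
        shift k B t ℤ.- B t    ≡⟨ cong (λ z → z ℤ.- B t) (shift-≥ B k≤t) ⟩
        B (t ∸ k) ℤ.- B t      ∎))
    where open ≡-Reasoning
  ... | no k≰t = ℤ.neg-injective (begin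
        - A t                  ≡⟨ ℤ.+-identityˡ (- A t) ⟨
        + 0 ℤ.- A t            ≡⟨ cong (λ z → z ℤ.- A t) (shift-< A t<k) ⟨
        shift k A t ℤ.- A t    ≡⟨ coeff-eq t ⟩
        shift k B t ℤ.- B t    ≡⟨ cong (λ z → z ℤ.- B t) (shift-< B t<k) ⟩
        + 0 ℤ.- B t            ≡⟨ ℤ.+-identityˡ (- B t) ⟩
        - B t                  ∎)
    where
    open ≡-Reasoning
    t<k = ℕ.≰⇒> k≰t

x^−1-cancelʳ : ∀ {k} → 1 ≤ k → ∀ {A B} → A · x^ k −1 ≈ B · x^ k −1 → A ≈ B
x^−1-cancelʳ 1≤k {A} {B} eq = x^−1-cancelˡ 1≤k (≈-trans (·-comm _ A) (≈-trans eq (·-comm B _)))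

IncreasingFrom : ℕ → List ℕ → Set
IncreasingFrom a []       = ⊤
IncreasingFrom a (d ∷ ds) = a ≤ d × IncreasingFrom (suc d) ds

IncreasingFrom-weaken : ∀ {a b} ds → a ≤ b → IncreasingFrom b ds → IncreasingFrom a ds
IncreasingFrom-weaken []       _   _            = tt
IncreasingFrom-weaken (d ∷ ds) a≤b (b≤d , inc) = ℕ.≤-trans a≤b b≤d , inc

IncreasingFrom-∈ : ∀ {a d} ds → IncreasingFrom a ds → d ∈ ds → a ≤ d
IncreasingFrom-∈ (x ∷ ds) (a≤x , inc) (here refl) = a≤x
IncreasingFrom-∈ (x ∷ ds) (a≤x , inc) (there d∈) = ℕ.≤-trans a≤x (ℕ.<⇒≤ (IncreasingFrom-∈ ds inc d∈))

IncreasingFrom-++ : ∀ {a b} xs {ys} → IncreasingFrom a xs → All (_< b) xs → a ≤ b →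
  IncreasingFrom b ys → IncreasingFrom a (xs ++ ys)
IncreasingFrom-++ []       _           _            a≤b incʸ = IncreasingFrom-weaken _ a≤b incʸ
IncreasingFrom-++ (x ∷ xs) (a≤x , inc) (x<b ∷ xs<b) _   incʸ = a≤x , IncreasingFrom-++ xs inc xs<b x<b incʸ

IncreasingFrom-map-* : ∀ {a} r → 1 ≤ r → ∀ ds → IncreasingFrom a ds → IncreasingFrom (a * r) (map (_* r) ds)
IncreasingFrom-map-* r 1≤r []       _           = tt
IncreasingFrom-map-* r 1≤r (d ∷ ds) (a≤d , inc) =
  ℕ.*-monoˡ-≤ r a≤d , IncreasingFrom-weaken _ (ℕ.+-monoˡ-≤ (d * r) 1≤r) (IncreasingFrom-map-* r 1≤r ds inc)

divisorsBelow : ℕ → ℕ → List ℕ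
divisorsBelow n N = filter (_∣? n) (upTo N)

divisorsBelow-suc : ∀ n N → divisorsBelow n (suc N) ≡ divisorsBelow n N ++ filter (_∣? n) (N ∷ [])
divisorsBelow-suc n N = trans (cong (filter (_∣? n)) (sym (upTo-∷ʳ N))) (filter-++ (_∣? n) (upTo N) (N ∷ []))

divisorsBelow-gap : ∀ {n a} N → a ≤ N → (∀ {d} → a ≤ d → d < N → ¬ d ∣ n) → divisorsBelow n N ≡ divisorsBelow n a
divisorsBelow-gap {n} {a} zero    z≤n  gap = refl
divisorsBelow-gap {n} {a} (suc N) a≤1+N gap with a ≤? N
... | no a≰N rewrite ℕ.≤-antisym a≤1+N (ℕ.≰⇒> a≰N) = refl
... | yes a≤N = begin
  divisorsBelow n (suc N)                          ≡⟨ divisorsBelow-suc n N ⟩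
  divisorsBelow n N ++ filter (_∣? n) (N ∷ [])     ≡⟨ cong (divisorsBelow n N ++_) (filter-reject (_∣? n) (gap a≤N ℕ.≤-refl)) ⟩
  divisorsBelow n N ++ []                          ≡⟨ ++-identityʳ _ ⟩
  divisorsBelow n N                                ≡⟨ divisorsBelow-gap N a≤N (λ a≤d d<N → gap a≤d (ℕ.m<n⇒m<1+n d<N)) ⟩
  divisorsBelow n a                                ∎
  where open ≡-Reasoning

divisorsBelow-≡ : ∀ {n a N} ds → IncreasingFrom a ds → a ≤ N → All (λ d → d ∣ n × d < N) ds →
  (∀ {d} → a ≤ d → d < N → d ∣ n → d ∈ ds) → divisorsBelow n N ≡ divisorsBelow n a ++ ds
divisorsBelow-≡ [] _ a≤N _ complete =
  trans (divisorsBelow-gap _ a≤N (λ a≤d d<N d∣n → case-∈[] (complete a≤d d<N d∣n))) (sym (++-identityʳ _))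
  where
  case-∈[] : ∀ {d} → d ∈ [] → _
  case-∈[] ()
divisorsBelow-≡ {n} {a} {N} (x ∷ ds) (a≤x , inc) a≤N ((x∣n , x<N) ∷ bounds) complete = begin
  divisorsBelow n N                                ≡⟨ divisorsBelow-≡ ds inc x<N bounds complete-above ⟩
  divisorsBelow n (suc x) ++ ds                    ≡⟨ cong (_++ ds) (divisorsBelow-suc n x) ⟩
  (divisorsBelow n x ++ filter (_∣? n) (x ∷ [])) ++ ds
    ≡⟨ cong₂ (λ l l′ → (l ++ l′) ++ ds) (divisorsBelow-gap x a≤x no-divisor-below) (filter-accept (_∣? n) x∣n) ⟩
  (divisorsBelow n a ++ x ∷ []) ++ ds              ≡⟨ ++-assoc (divisorsBelow n a) (x ∷ []) ds ⟩
  divisorsBelow n a ++ x ∷ ds                      ∎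
  where
  open ≡-Reasoning
  complete-above : ∀ {d} → suc x ≤ d → d < N → d ∣ n → d ∈ ds
  complete-above x<d d<N d∣n with complete (ℕ.≤-trans a≤x (ℕ.<⇒≤ x<d)) d<N d∣n
  ... | here refl = contradiction x<d (ℕ.<-irrefl refl)
  ... | there d∈ = d∈
  no-divisor-below : ∀ {d} → a ≤ d → d < x → ¬ d ∣ n
  no-divisor-below a≤d d<x d∣n with complete a≤d (ℕ.<-trans d<x x<N) d∣n
  ... | here refl = ℕ.<-irrefl refl d<x
  ... | there d∈ = ℕ.<-asym d<x (IncreasingFrom-∈ ds inc d∈)

record DivisorList (n : ℕ) (ds : List ℕ) : Set where
  field
    increasing : IncreasingFrom 1 ds
    sound      : All (_∣ n) ds
    complete   : ∀ {d} → d ∣ n → d ∈ ds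

divisors-unique : ∀ {n ds} → 1 ≤ n → DivisorList n ds → divisors n ≡ ds
divisors-unique {n} {ds} 1≤n D =
  divisorsBelow-≡ ds (IncreasingFrom-weaken ds z≤n increasing) z≤n
    (All.map (λ d∣n → d∣n , s≤s (∣⇒≤ {{ℕ.>-nonZero 1≤n}} d∣n)) sound) (λ _ _ → complete)
  where open DivisorList D

divisorList-1 : DivisorList 1 (1 ∷ [])
divisorList-1 = record
  { increasing = ℕ.≤-refl , tt
  ; sound      = 1∣ 1 ∷ []
  ; complete   = λ d∣1 → here (∣1⇒≡1 d∣1)
  }

∣*prime⇒∣⊎≡*prime : ∀ {d} n {r} → Prime r → d ∣ n * r → d ∣ n ⊎ ∃[ e ] (d ≡ e * r × e ∣ n)
∣*prime⇒∣⊎≡*prime {d} n {r} pr d∣nr with r ∣? d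
... | yes (divides e refl) = inj₂ (e , refl , *-cancelʳ-∣ r {{prime⇒nonZero pr}} d∣nr)
... | no r∤d = inj₁ (coprime-divisor d⊥r (subst (d ∣_) (ℕ.*-comm n r) d∣nr))
  where
  d⊥r : Coprime d r
  d⊥r (c∣d , c∣r) with prime⇒irreducible pr c∣r
  ... | inj₁ c≡1 = c≡1
  ... | inj₂ refl = contradiction c∣d r∤d

divisorList-*-prime : ∀ {n r ds} → Prime r → 1 ≤ n → n < r → DivisorList n ds →
  DivisorList (n * r) (ds ++ map (_* r) ds)
divisorList-*-prime {n} {r} {ds} pr 1≤n n<r D = record
  { increasing = IncreasingFrom-++ ds increasing (All.map below-r sound) (subst (1 ≤_) (sym (ℕ.*-identityˡ r)) 1≤r)
                   (IncreasingFrom-map-* r 1≤r ds increasing)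
  ; sound      = ++⁺ (All.map (λ d∣n → ∣-trans d∣n (m∣m*n r)) sound) (map⁺ (All.map (*-monoˡ-∣ r) sound))
  ; complete   = complete′
  }
  where
  open DivisorList D
  1≤r : 1 ≤ r
  1≤r = ℕ.≤-trans 1≤n (ℕ.<⇒≤ n<r)
  below-r : ∀ {d} → d ∣ n → d < 1 * r
  below-r d∣n = subst (_ <_) (sym (ℕ.*-identityˡ r)) (ℕ.≤-<-trans (∣⇒≤ {{ℕ.>-nonZero 1≤n}} d∣n) n<r)
  complete′ : ∀ {d} → d ∣ n * r → d ∈ ds ++ map (_* r) ds
  complete′ d∣nr with ∣*prime⇒∣⊎≡*prime n pr d∣nr
  ... | inj₁ d∣n              = ∈-++⁺ˡ (complete d∣n)
  ... | inj₂ (e , refl , e∣n) = ∈-++⁺ʳ ds (∈-map⁺ (_* r) (complete e∣n))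

divisorList-*-prime₁ : ∀ {n r ds} → Prime r → 1 ≤ n → n < r → DivisorList n (1 ∷ ds) →
  DivisorList (n * r) (1 ∷ ds ++ r ∷ map (_* r) ds)
divisorList-*-prime₁ {n} {r} {ds} pr 1≤n n<r D =
  subst (λ q → DivisorList (n * r) (1 ∷ ds ++ q ∷ map (_* r) ds)) (ℕ.*-identityˡ r)
        (divisorList-*-prime pr 1≤n n<r D)

divisorList-prime : ∀ {p} → Prime p → DivisorList p (1 ∷ p ∷ [])
divisorList-prime {p} pp = subst (λ q → DivisorList q (1 ∷ q ∷ [])) (ℕ.*-identityˡ p)
  (divisorList-*-prime pp ℕ.≤-refl (ℕ.nonTrivial⇒n>1 p {{prime⇒nonTrivial pp}}) divisorList-1)

cyclotomic-product : ∀ {Φ} → IsCyclotomicFamily Φ → ∀ {n ds} → 1 ≤ n → DivisorList n ds →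
  ∏ (map Φ ds) ≈ x^ n −1
cyclotomic-product {Φ} cyc {n} {ds} 1≤n D .coeff k = begin
  ∏ (map Φ ds) k                  ≡⟨ cong (λ f → f k) (prodS≡∏ (map Φ ds)) ⟨
  prodS (map Φ ds) k              ≡⟨ cong (λ ds → prodS (map Φ ds) k) (divisors-unique 1≤n D) ⟨
  prodS (map Φ (divisors n)) k    ≡⟨ cyc n 1≤n k ⟩
  x^ n −1 k                       ∎
  where open ≡-Reasoning

infix 8 _[x^_]

-- f(xʳ); junk for r = 0, so every lemma about it assumes 1 ≤ r.
_[x^_] : Series → ℕ → Series
(f [x^ r ]) t with r ∣? t
... | yes (divides a _) = f a
... | no _              = + 0

module _ {r : ℕ} (1≤r : 1 ≤ r) where

  private instance
    r≢0 : NonZero r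
    r≢0 = ℕ.>-nonZero 1≤r

  [x^]-multiple : ∀ f a → (f [x^ r ]) (a * r) ≡ f a
  [x^]-multiple f a with r ∣? a * r
  ... | yes (divides a′ eq) = cong f (ℕ.*-cancelʳ-≡ a′ a r (sym eq))
  ... | no r∤ar             = contradiction (n∣m*n a) r∤ar

  [x^]-nonmultiple : ∀ f {t} → ¬ r ∣ t → (f [x^ r ]) t ≡ + 0
  [x^]-nonmultiple f {t} r∤t with r ∣? t
  ... | yes r∣t = contradiction r∣t r∤t
  ... | no _    = refl

  nonmultiple-between : ∀ {b j} → b * r < j → j < suc b * r → ¬ r ∣ j
  nonmultiple-between {b} lo hi (divides c refl) =
    ℕ.<-irrefl refl (ℕ.<-≤-trans (ℕ.*-cancelʳ-< r b c lo) (ℕ.≤-pred (ℕ.*-cancelʳ-< r c (suc b) hi)))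

  between-multiples : ∀ t → ∃[ b ] (b * r ≤ t × t < suc b * r)
  between-multiples t = t / r , m/n*n≤m t r , (begin-strict
    t                     ≡⟨ m≡m%n+[m/n]*n t r ⟩
    t % r + t / r * r     <⟨ ℕ.+-monoˡ-< (t / r * r) (m%n<n t r) ⟩
    r + t / r * r         ∎)
    where open ℕ.≤-Reasoning

  [x^]-cong : ∀ {f g} → f ≈ g → f [x^ r ] ≈ g [x^ r ]
  [x^]-cong {f} {g} f≈g .coeff t with r ∣? t
  ... | yes (divides a _) = f≈g .coeff a
  ... | no _              = refl

  [x^]-suc : ∀ f j → (f [x^ r ]) (r + j) ≡ ((f ∘ suc) [x^ r ]) j
  [x^]-suc f j with r ∣? j
  ... | yes (divides c refl) = [x^]-multiple f (suc c)
  ... | no r∤j               = [x^]-nonmultiple f (λ r∣r+j → r∤j (∣m+n∣m⇒∣n r∣r+j ∣-refl))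

  ∑-[x^] : ∀ f (F : ℕ → ℤ) b → ∑ (b * r) (λ j → (f [x^ r ]) j ℤ.* F j) ≡ ∑ b (λ a → f a ℤ.* F (a * r))
  ∑-[x^] f F zero    = refl
  ∑-[x^] f F (suc b) = begin
    ∑ (r + b * r) (λ j → (f [x^ r ]) j ℤ.* F j)
      ≡⟨ ∑-split r (b * r) _ ⟩
    ∑ r (λ j → (f [x^ r ]) j ℤ.* F j) ℤ.+ ∑ (b * r) (λ j → (f [x^ r ]) (r + j) ℤ.* F (r + j))
      ≡⟨ cong₂ ℤ._+_ first-block (∑-cong′ (b * r) (λ j → cong (ℤ._* F (r + j)) ([x^]-suc f j))) ⟩
    f 0 ℤ.* F 0 ℤ.+ ∑ (b * r) (λ j → ((f ∘ suc) [x^ r ]) j ℤ.* F (r + j))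
      ≡⟨ cong (λ z → f 0 ℤ.* F 0 ℤ.+ z) (∑-[x^] (f ∘ suc) (λ j → F (r + j)) b) ⟩
    ∑ (suc b) (λ a → f a ℤ.* F (a * r)) ∎
    where
    open ≡-Reasoning
    first-block : ∑ r (λ j → (f [x^ r ]) j ℤ.* F j) ≡ f 0 ℤ.* F 0
    first-block = begin
      ∑ r (λ j → (f [x^ r ]) j ℤ.* F j)            ≡⟨ ∑-truncate _ 1≤r off-multiples ⟩
      (f [x^ r ]) 0 ℤ.* F 0 ℤ.+ + 0                ≡⟨ ℤ.+-identityʳ _ ⟩
      (f [x^ r ]) 0 ℤ.* F 0                        ≡⟨ cong (ℤ._* F 0) ([x^]-multiple f 0) ⟩
      f 0 ℤ.* F 0                                  ∎
      where
      off-multiples : ∀ j → 1 ≤ j → j < r → (f [x^ r ]) j ℤ.* F j ≡ + 0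
      off-multiples j 1≤j j<r = cong (ℤ._* F j)
        ([x^]-nonmultiple f (λ r∣j → ℕ.<⇒≱ j<r (∣⇒≤ {{ℕ.>-nonZero 1≤j}} r∣j)))

  [x^]-·-coeff : ∀ {b t} → b * r ≤ t → t < suc b * r → ∀ f g →
    (f [x^ r ] · g) t ≡ ∑ (suc b) (λ a → f a ℤ.* g (t ∸ a * r))
  [x^]-·-coeff {b} {t} lo hi f g = begin
    (f [x^ r ] · g) t                                    ≡⟨ ·-coeff (f [x^ r ]) g t ⟩
    ∑ (suc t) (λ j → (f [x^ r ]) j ℤ.* g (t ∸ j))        ≡⟨ ∑-truncate _ hi beyond-t ⟨
    ∑ (suc b * r) (λ j → (f [x^ r ]) j ℤ.* g (t ∸ j))    ≡⟨ ∑-[x^] f (λ j → g (t ∸ j)) (suc b) ⟩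
    ∑ (suc b) (λ a → f a ℤ.* g (t ∸ a * r))              ∎
    where
    open ≡-Reasoning
    beyond-t : ∀ j → suc t ≤ j → j < suc b * r → (f [x^ r ]) j ℤ.* g (t ∸ j) ≡ + 0
    beyond-t j t<j j<  = cong (ℤ._* g (t ∸ j))
      ([x^]-nonmultiple f (nonmultiple-between {b} (ℕ.≤-<-trans lo t<j) j<))

  [x^]-· : ∀ f g → (f · g) [x^ r ] ≈ f [x^ r ] · g [x^ r ]
  [x^]-· f g .coeff t = by-divisibility t (r ∣? t)
    where
    -- Not `with r ∣? t`: that would also abstract the occurrences of r ∣? (t ∸ 0) on the right.
    by-divisibility : ∀ t → Dec (r ∣ t) → ((f · g) [x^ r ]) t ≡ (f [x^ r ] · g [x^ r ]) t
    by-divisibility .(b * r) (yes (divides b refl)) = begin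
      ((f · g) [x^ r ]) (b * r)
        ≡⟨ [x^]-multiple (f · g) b ⟩
      (f · g) b
        ≡⟨ ·-coeff f g b ⟩
      ∑ (suc b) (λ a → f a ℤ.* g (b ∸ a))
        ≡⟨ ∑-cong′ (suc b) (λ a → cong (f a ℤ.*_) (trans (sym ([x^]-multiple g (b ∸ a)))
                                                           (cong (g [x^ r ]) (ℕ.*-distribʳ-∸ r b a)))) ⟩
      ∑ (suc b) (λ a → f a ℤ.* (g [x^ r ]) (b * r ∸ a * r))
        ≡⟨ [x^]-·-coeff {b} ℕ.≤-refl (ℕ.m<n+m (b * r) 1≤r) f (g [x^ r ]) ⟨
      (f [x^ r ] · g [x^ r ]) (b * r) ∎
      where open ≡-Reasoning
    by-divisibility t (no r∤t) with between-multiples t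
    ... | b , lo , hi = begin
      ((f · g) [x^ r ]) t                                  ≡⟨ [x^]-nonmultiple (f · g) r∤t ⟩
      + 0                                                  ≡⟨ ∑-zero (suc b) terms-vanish ⟨
      ∑ (suc b) (λ a → f a ℤ.* (g [x^ r ]) (t ∸ a * r))   ≡⟨ [x^]-·-coeff {b} lo hi f (g [x^ r ]) ⟨
      (f [x^ r ] · g [x^ r ]) t                            ∎
      where
      open ≡-Reasoning
      terms-vanish : ∀ a → a < suc b → f a ℤ.* (g [x^ r ]) (t ∸ a * r) ≡ + 0
      terms-vanish a (s≤s a≤b) = trans (cong (f a ℤ.*_) ([x^]-nonmultiple g r∤t∸ar)) (ℤ.*-zeroʳ (f a))
        where r∤t∸ar = λ r∣ → r∤t (∣m∸n∣n⇒∣m r (ℕ.≤-trans (ℕ.*-monoˡ-≤ r a≤b) lo) r∣ (n∣m*n a))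

  does-≟-*ʳ : ∀ a b → does (a * r ≟ b * r) ≡ does (a ≟ b)
  does-≟-*ʳ a b with a ≟ b
  ... | yes refl = trans (dec-true (a * r ≟ a * r) refl) (sym (dec-true (a ≟ a) refl))
  ... | no a≢b   = trans (dec-false (a * r ≟ b * r) (λ eq → a≢b (ℕ.*-cancelʳ-≡ a b r eq)))
                         (sym (dec-false (a ≟ b) a≢b))

  [x^]-x^−1 : ∀ k → x^ k −1 [x^ r ] ≈ x^ (k * r) −1
  [x^]-x^−1 k .coeff t with r ∣? t
  ... | yes (divides a refl) =
    sym (cong₂ (λ b c → if b then + 1 else (if c then - + 1 else + 0)) (does-≟-*ʳ a k) (does-≟-*ʳ a 0))
  ... | no r∤t
    rewrite dec-false (t ≟ k * r) (λ eq → r∤t (divides k eq))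
          | dec-false (t ≟ 0) (λ eq → r∤t (divides 0 eq)) = refl

  [x^]-x^1−1 : x^ 1 −1 [x^ r ] ≈ x^ r −1
  [x^]-x^1−1 = ≈-trans ([x^]-x^−1 1) (x^−1-cong (ℕ.*-identityˡ r))

  [x^]-one : oneS [x^ r ] ≈ oneS
  [x^]-one .coeff t with r ∣? t
  [x^]-one .coeff t       | yes (divides zero    refl) = refl
  [x^]-one .coeff t       | yes (divides (suc a) refl) = sym (oneS-positive (ℕ.≤-trans 1≤r (ℕ.m≤m+n r (a * r))))
    where
    oneS-positive : ∀ {t} → 1 ≤ t → oneS t ≡ + 0
    oneS-positive {suc t} _ = refl
  [x^]-one .coeff zero    | no r∤0 = contradiction (divides 0 refl) r∤0
  [x^]-one .coeff (suc t) | no _   = refl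

1/[x−1] : Series
1/[x−1] _ = - + 1

1+x : Series
1+x 0 = + 1
1+x 1 = + 1
1+x _ = + 0

1+x+x² : Series
1+x+x² 0 = + 1
1+x+x² 1 = + 1
1+x+x² 2 = + 1
1+x+x² _ = + 0

1−x+x² : Series
1−x+x² 0 = + 1
1−x+x² 1 = - + 1
1−x+x² 2 = + 1
1−x+x² _ = + 0

1+x³ : Series
1+x³ 0 = + 1
1+x³ 3 = + 1
1+x³ _ = + 0

-- (1 + x)/(1 + x³), of period 6
1/[1−x+x²] : Series
1/[1−x+x²] 0 = + 1
1/[1−x+x²] 1 = + 1
1/[1−x+x²] 2 = + 0
1/[1−x+x²] 3 = - + 1
1/[1−x+x²] 4 = - + 1
1/[1−x+x²] 5 = + 0
1/[1−x+x²] (suc (suc (suc (suc (suc (suc t)))))) = 1/[1−x+x²] t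

[1/[x−1]][x−1]≈1 : 1/[x−1] · x^ 1 −1 ≈ oneS
[1/[x−1]][x−1]≈1 .coeff t = trans (·-x^−1-coeff (s≤s z≤n) 1/[x−1] t) (by-cases t)
  where
  by-cases : ∀ t → shift 1 1/[x−1] t ℤ.- 1/[x−1] t ≡ oneS t
  by-cases zero    = refl
  by-cases (suc t) = refl

[1+x][x−1]≈x²−1 : 1+x · x^ 1 −1 ≈ x^ 2 −1
[1+x][x−1]≈x²−1 .coeff t = trans (·-x^−1-coeff (s≤s z≤n) 1+x t) (by-cases t)
  where
  by-cases : ∀ t → shift 1 1+x t ℤ.- 1+x t ≡ x^ 2 −1 t
  by-cases 0 = refl
  by-cases 1 = refl
  by-cases 2 = refl
  by-cases (suc (suc (suc t))) = refl

[1+x+x²][x−1]≈x³−1 : 1+x+x² · x^ 1 −1 ≈ x^ 3 −1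
[1+x+x²][x−1]≈x³−1 .coeff t = trans (·-x^−1-coeff (s≤s z≤n) 1+x+x² t) (by-cases t)
  where
  by-cases : ∀ t → shift 1 1+x+x² t ℤ.- 1+x+x² t ≡ x^ 3 −1 t
  by-cases 0 = refl
  by-cases 1 = refl
  by-cases 2 = refl
  by-cases 3 = refl
  by-cases (suc (suc (suc (suc t)))) = refl

[1+x³][x³−1]≈x⁶−1 : 1+x³ · x^ 3 −1 ≈ x^ 6 −1
[1+x³][x³−1]≈x⁶−1 .coeff t = trans (·-x^−1-coeff (s≤s z≤n) 1+x³ t) (by-cases t)
  where
  by-cases : ∀ t → shift 3 1+x³ t ℤ.- 1+x³ t ≡ x^ 6 −1 t
  by-cases 0 = refl
  by-cases 1 = refl
  by-cases 2 = refl
  by-cases 3 = refl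
  by-cases 4 = refl
  by-cases 5 = refl
  by-cases 6 = refl
  by-cases (suc (suc (suc (suc (suc (suc (suc t))))))) = refl

[1/[1−x+x²]][x⁶−1]≈[1+x][x³−1] : 1/[1−x+x²] · x^ 6 −1 ≈ 1+x · x^ 3 −1
[1/[1−x+x²]][x⁶−1]≈[1+x][x³−1] .coeff t =
  trans (·-x^−1-coeff (s≤s z≤n) 1/[1−x+x²] t) (trans (by-cases t) (sym (·-x^−1-coeff (s≤s z≤n) 1+x t)))
  where
  by-cases : ∀ t → shift 6 1/[1−x+x²] t ℤ.- 1/[1−x+x²] t ≡ shift 3 1+x t ℤ.- 1+x t
  by-cases 0 = refl
  by-cases 1 = refl
  by-cases 2 = refl
  by-cases 3 = refl
  by-cases 4 = refl
  by-cases 5 = refl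
  by-cases (suc (suc (suc (suc (suc (suc t)))))) = ℤ.+-inverseʳ (1/[1−x+x²] t)

[1−x+x²][1+x]≈1+x³ : 1−x+x² · 1+x ≈ 1+x³
[1−x+x²][1+x]≈1+x³ .coeff 0 = ·-coeff 1−x+x² 1+x 0
[1−x+x²][1+x]≈1+x³ .coeff 1 = ·-coeff 1−x+x² 1+x 1
[1−x+x²][1+x]≈1+x³ .coeff 2 = ·-coeff 1−x+x² 1+x 2
[1−x+x²][1+x]≈1+x³ .coeff (suc (suc (suc t))) = begin
  (1−x+x² · 1+x) (3 + t)                                    ≡⟨ ·-coeff 1−x+x² 1+x (3 + t) ⟩
  ∑ (4 + t) (λ j → 1−x+x² j ℤ.* 1+x (3 + t ∸ j))            ≡⟨ ∑-truncate _ (s≤s (s≤s (s≤s z≤n))) high-degree ⟩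
  ∑ 3 (λ j → 1−x+x² j ℤ.* 1+x (3 + t ∸ j))                  ≡⟨ low-degree t ⟩
  1+x³ (3 + t)                                              ∎
  where
  open ≡-Reasoning
  high-degree : ∀ j → 3 ≤ j → j < 4 + t → 1−x+x² j ℤ.* 1+x (3 + t ∸ j) ≡ + 0
  high-degree (suc (suc (suc j))) _                  _ = refl
  high-degree 0                   ()                 _
  high-degree 1                   (s≤s ())           _
  high-degree 2                   (s≤s (s≤s ()))     _
  low-degree : ∀ t → ∑ 3 (λ j → 1−x+x² j ℤ.* 1+x (3 + t ∸ j)) ≡ 1+x³ (3 + t)
  low-degree 0       = refl
  low-degree (suc t) = refl

1−x+x²-vanishes : ∀ {t} → 3 ≤ t → 1−x+x² t ≡ + 0
1−x+x²-vanishes {suc (suc (suc _))} _ = refl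
1−x+x²-vanishes {0}                  ()
1−x+x²-vanishes {1}                  (s≤s ())
1−x+x²-vanishes {2}                  (s≤s (s≤s ()))

1+x+x²-vanishes : ∀ {t} → 3 ≤ t → 1+x+x² t ≡ + 0
1+x+x²-vanishes {suc (suc (suc _))} _ = refl
1+x+x²-vanishes {0}                  ()
1+x+x²-vanishes {1}                  (s≤s ())
1+x+x²-vanishes {2}                  (s≤s (s≤s ()))

1≤m*n : ∀ {m n} → 1 ≤ m → 1 ≤ n → 1 ≤ m * n
1≤m*n = ℕ.*-mono-≤

1/[x^_−1] : ℕ → Series
1/[x^ k −1] = 1/[x−1] [x^ k ]

[1/[xᵏ−1]][xᵏ−1]≈1 : ∀ {k} → 1 ≤ k → 1/[x^ k −1] · x^ k −1 ≈ oneS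
[1/[xᵏ−1]][xᵏ−1]≈1 {k} 1≤k = begin
  1/[x−1] [x^ k ] · x^ k −1              ≈⟨ ·-cong ≈-refl ([x^]-x^1−1 1≤k) ⟨
  1/[x−1] [x^ k ] · x^ 1 −1 [x^ k ]      ≈⟨ [x^]-· 1≤k 1/[x−1] (x^ 1 −1) ⟨
  (1/[x−1] · x^ 1 −1) [x^ k ]            ≈⟨ [x^]-cong 1≤k [1/[x−1]][x−1]≈1 ⟩
  oneS [x^ k ]                           ≈⟨ [x^]-one 1≤k ⟩
  oneS                                   ∎
  where open ≈-Reasoning

1/Φ₃ₚ : ℕ → Series
1/Φ₃ₚ p = 1+x+x² · x^ p −1 · 1/[x^ (3 * p) −1]

[x³ᵖ−1][1/Φ₃ₚ]≈[1+x+x²][xᵖ−1] : ∀ {p} → 1 ≤ p → x^ (3 * p) −1 · 1/Φ₃ₚ p ≈ 1+x+x² · x^ p −1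
[x³ᵖ−1][1/Φ₃ₚ]≈[1+x+x²][xᵖ−1] {p} 1≤p = begin
  x^ (3 * p) −1 · (1+x+x² · x^ p −1 · 1/[x^ (3 * p) −1])
    ≈⟨ solve 3 (λ a b c → b ⊕ (a ⊕ c) ⊜ a ⊕ (c ⊕ b)) ≈-refl (1+x+x² · x^ p −1) (x^ (3 * p) −1) 1/[x^ (3 * p) −1] ⟩
  1+x+x² · x^ p −1 · (1/[x^ (3 * p) −1] · x^ (3 * p) −1)
    ≈⟨ ·-cong ≈-refl ([1/[xᵏ−1]][xᵏ−1]≈1 (1≤m*n {3} (s≤s z≤n) 1≤p)) ⟩
  1+x+x² · x^ p −1 · oneS
    ≈⟨ ·-identityʳ _ ⟩
  1+x+x² · x^ p −1 ∎
  where open ≈-Reasoning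

[1/Φ₃ₚ][x³ᵖ−1][x−1]≈[x³−1][xᵖ−1] : ∀ {p} → 1 ≤ p → 1/Φ₃ₚ p · x^ (3 * p) −1 · x^ 1 −1 ≈ x^ 3 −1 · x^ p −1
[1/Φ₃ₚ][x³ᵖ−1][x−1]≈[x³−1][xᵖ−1] {p} 1≤p = begin
  1/Φ₃ₚ p · x^ (3 * p) −1 · x^ 1 −1
    ≈⟨ solve 3 (λ h X x₁ → (h ⊕ X) ⊕ x₁ ⊜ x₁ ⊕ (X ⊕ h)) ≈-refl (1/Φ₃ₚ p) (x^ (3 * p) −1) (x^ 1 −1) ⟩
  x^ 1 −1 · (x^ (3 * p) −1 · 1/Φ₃ₚ p)
    ≈⟨ ·-cong ≈-refl ([x³ᵖ−1][1/Φ₃ₚ]≈[1+x+x²][xᵖ−1] 1≤p) ⟩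
  x^ 1 −1 · (1+x+x² · x^ p −1)
    ≈⟨ solve 3 (λ x₁ t xₚ → x₁ ⊕ (t ⊕ xₚ) ⊜ (t ⊕ x₁) ⊕ xₚ) ≈-refl (x^ 1 −1) 1+x+x² (x^ p −1) ⟩
  1+x+x² · x^ 1 −1 · x^ p −1
    ≈⟨ ·-cong [1+x+x²][x−1]≈x³−1 ≈-refl ⟩
  x^ 3 −1 · x^ p −1 ∎
  where open ≈-Reasoning

-- (x³ᵖ − 1)·1/Φ₃ₚ = (1 + x + x²)(xᵖ − 1) has no terms of degree ≥ 3p.
1/Φ₃ₚ-step : ∀ {p} → 2 ≤ p → ∀ s → 1/Φ₃ₚ p (3 * p + s) ≡ 1/Φ₃ₚ p s
1/Φ₃ₚ-step {p} 2≤p s = sym (ℤ.i-j≡0⇒i≡j _ _ (begin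
  1/Φ₃ₚ p s ℤ.- 1/Φ₃ₚ p (3 * p + s)
    ≡⟨ cong (ℤ._- 1/Φ₃ₚ p (3 * p + s)) (trans (cong (1/Φ₃ₚ p) (sym (ℕ.m+n∸m≡n (3 * p) s)))
                                             (sym (shift-≥ (1/Φ₃ₚ p) (ℕ.m≤m+n (3 * p) s)))) ⟩
  shift (3 * p) (1/Φ₃ₚ p) (3 * p + s) ℤ.- 1/Φ₃ₚ p (3 * p + s)
    ≡⟨ x^−1-·-coeff 1≤3p (1/Φ₃ₚ p) (3 * p + s) ⟨
  (x^ (3 * p) −1 · 1/Φ₃ₚ p) (3 * p + s)
    ≡⟨ [x³ᵖ−1][1/Φ₃ₚ]≈[1+x+x²][xᵖ−1] 1≤p .coeff (3 * p + s) ⟩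
  (1+x+x² · x^ p −1) (3 * p + s)
    ≡⟨ ·-x^−1-coeff 1≤p 1+x+x² (3 * p + s) ⟩
  shift p 1+x+x² (3 * p + s) ℤ.- 1+x+x² (3 * p + s)
    ≡⟨ cong₂ ℤ._-_ (trans (shift-≥ 1+x+x² p≤3p+s) (1+x+x²-vanishes 3≤3p+s∸p)) (1+x+x²-vanishes 3≤3p+s) ⟩
  + 0 ∎))
  where
  open ≡-Reasoning
  1≤p = ℕ.≤-trans (s≤s z≤n) 2≤p
  1≤3p = 1≤m*n {3} (s≤s z≤n) 1≤p
  p≤3p+s = ℕ.≤-trans (ℕ.m≤m+n p (2 * p)) (ℕ.m≤m+n (3 * p) s)
  3≤3p+s = ℕ.≤-trans (ℕ.*-monoʳ-≤ 3 1≤p) (ℕ.m≤m+n (3 * p) s)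
  3≤3p+s∸p : 3 ≤ 3 * p + s ∸ p
  3≤3p+s∸p = subst (3 ≤_) (sym (trans (cong (_∸ p) (ℕ.+-assoc p (2 * p) s)) (ℕ.m+n∸m≡n p (2 * p + s))))
                  (ℕ.≤-trans (ℕ.≤-trans (ℕ.n≤1+n 3) (ℕ.*-monoʳ-≤ 2 2≤p)) (ℕ.m≤m+n (2 * p) s))

1/Φ₃ₚ-periodic : ∀ {p} → 2 ≤ p → ∀ k s → 1/Φ₃ₚ p (k * (3 * p) + s) ≡ 1/Φ₃ₚ p s
1/Φ₃ₚ-periodic 2≤p zero    s = refl
1/Φ₃ₚ-periodic {p} 2≤p (suc k) s = begin
  1/Φ₃ₚ p (3 * p + k * (3 * p) + s)    ≡⟨ cong (1/Φ₃ₚ p) (ℕ.+-assoc (3 * p) (k * (3 * p)) s) ⟩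
  1/Φ₃ₚ p (3 * p + (k * (3 * p) + s))  ≡⟨ 1/Φ₃ₚ-step 2≤p (k * (3 * p) + s) ⟩
  1/Φ₃ₚ p (k * (3 * p) + s)            ≡⟨ 1/Φ₃ₚ-periodic 2≤p k s ⟩
  1/Φ₃ₚ p s                            ∎
  where open ≡-Reasoning

1/Φ₃ₚ-r≡2[mod3p] : ∀ {p} → 2 ≤ p → ∀ q {a i} l → a ≤ i →
  let r = q * (3 * p) + 2 in
  1/Φ₃ₚ p (i * r + (q * (3 * p) + l) ∸ a * r) ≡ 1/Φ₃ₚ p (i * 2 + l ∸ a * 2)
1/Φ₃ₚ-r≡2[mod3p] {p} 2≤p q {a} {i} l a≤i =
  subst (λ i → 1/Φ₃ₚ p (i * r + (m + l) ∸ a * r) ≡ 1/Φ₃ₚ p (i * 2 + l ∸ a * 2)) (ℕ.m+[n∸m]≡n a≤i) (begin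
    1/Φ₃ₚ p ((a + d) * r + (m + l) ∸ a * r)    ≡⟨ cong (1/Φ₃ₚ p) (cancel-a r (m + l)) ⟩
    1/Φ₃ₚ p (d * r + (m + l))                  ≡⟨ cong (1/Φ₃ₚ p) (regroup d q (3 * p) l) ⟩
    1/Φ₃ₚ p ((d * q + q) * (3 * p) + (d * 2 + l)) ≡⟨ 1/Φ₃ₚ-periodic 2≤p (d * q + q) (d * 2 + l) ⟩
    1/Φ₃ₚ p (d * 2 + l)                        ≡⟨ cong (1/Φ₃ₚ p) (cancel-a 2 l) ⟨
    1/Φ₃ₚ p ((a + d) * 2 + l ∸ a * 2)          ∎)
  where
  open ≡-Reasoning
  m = q * (3 * p)
  r = m + 2
  d = i ∸ a
  cancel-a : ∀ n x → (a + d) * n + x ∸ a * n ≡ d * n + x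
  cancel-a n x = trans (cong (_∸ a * n) (trans (cong (_+ x) (ℕ.*-distribʳ-+ n a d)) (ℕ.+-assoc (a * n) (d * n) x)))
                       (ℕ.m+n∸m≡n (a * n) (d * n + x))
  regroup : ∀ d q m l → d * (q * m + 2) + (q * m + l) ≡ (d * q + q) * m + (d * 2 + l)
  regroup = ℕ-Ring.solve-∀

-- Inclusion–exclusion over the divisors of 3pr; it determines F, as xᵏ − 1 is cancellable.
Φ₃ₚᵣ-Equation : ℕ → ℕ → Series → Set
Φ₃ₚᵣ-Equation p r F =
  F · x^ (3 * p) −1 · x^ (3 * r) −1 · x^ (p * r) −1 · x^ 1 −1 ≈ x^ (3 * p * r) −1 · x^ 3 −1 · x^ p −1 · x^ r −1

Φ₃ₚᵣ-Equation-unique : ∀ {p r F G} → 1 ≤ p → 1 ≤ r → Φ₃ₚᵣ-Equation p r F → Φ₃ₚᵣ-Equation p r G → F ≈ G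
Φ₃ₚᵣ-Equation-unique 1≤p 1≤r eqF eqG =
  x^−1-cancelʳ (1≤m*n {3} (s≤s z≤n) 1≤p) (x^−1-cancelʳ (1≤m*n {3} (s≤s z≤n) 1≤r)
    (x^−1-cancelʳ (1≤m*n 1≤p 1≤r) (x^−1-cancelʳ (s≤s z≤n) (≈-trans eqF (≈-sym eqG)))))

[1−x+x²][xᵖ]/[1−x+x²]-solves : ∀ {p} → 1 ≤ p → Φ₃ₚᵣ-Equation p 2 (1−x+x² [x^ p ] · 1/[1−x+x²])
[1−x+x²][xᵖ]/[1−x+x²]-solves {p} 1≤p = begin
  1−x+x² [x^ p ] · 1/[1−x+x²] · x^ (3 * p) −1 · x^ 6 −1 · x^ (p * 2) −1 · x^ 1 −1
    ≈⟨ ·-cong (·-cong (·-cong (·-cong ≈-refl ([x^]-x^−1 1≤p 3)) ≈-refl) (≈-sym x^2p−1)) ≈-refl ⟨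
  1−x+x² [x^ p ] · 1/[1−x+x²] · x^ 3 −1 [x^ p ] · x^ 6 −1 · (1+x [x^ p ] · x^ p −1) · x^ 1 −1
    ≈⟨ solve 7 (λ a j b c d e f → ((((a ⊕ j) ⊕ b) ⊕ c) ⊕ (d ⊕ e)) ⊕ f ⊜ ((((a ⊕ d) ⊕ b) ⊕ (j ⊕ c)) ⊕ e) ⊕ f)
             ≈-refl (1−x+x² [x^ p ]) 1/[1−x+x²] (x^ 3 −1 [x^ p ]) (x^ 6 −1) (1+x [x^ p ]) (x^ p −1) (x^ 1 −1) ⟩
  1−x+x² [x^ p ] · 1+x [x^ p ] · x^ 3 −1 [x^ p ] · (1/[1−x+x²] · x^ 6 −1) · x^ p −1 · x^ 1 −1
    ≈⟨ ·-cong (·-cong (·-cong x^6p−1 [1/[1−x+x²]][x⁶−1]≈[1+x][x³−1]) ≈-refl) ≈-refl ⟩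
  x^ (3 * p * 2) −1 · (1+x · x^ 3 −1) · x^ p −1 · x^ 1 −1
    ≈⟨ solve 5 (λ a d b c e → ((a ⊕ (d ⊕ b)) ⊕ c) ⊕ e ⊜ ((a ⊕ b) ⊕ c) ⊕ (d ⊕ e))
             ≈-refl (x^ (3 * p * 2) −1) 1+x (x^ 3 −1) (x^ p −1) (x^ 1 −1) ⟩
  x^ (3 * p * 2) −1 · x^ 3 −1 · x^ p −1 · (1+x · x^ 1 −1)
    ≈⟨ ·-cong ≈-refl [1+x][x−1]≈x²−1 ⟩
  x^ (3 * p * 2) −1 · x^ 3 −1 · x^ p −1 · x^ 2 −1 ∎
  where
  open ≈-Reasoning
  x^2p−1 : x^ (p * 2) −1 ≈ 1+x [x^ p ] · x^ p −1
  x^2p−1 = begin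
    x^ (p * 2) −1                   ≈⟨ x^−1-cong (ℕ.*-comm p 2) ⟩
    x^ (2 * p) −1                   ≈⟨ [x^]-x^−1 1≤p 2 ⟨
    x^ 2 −1 [x^ p ]                 ≈⟨ [x^]-cong 1≤p [1+x][x−1]≈x²−1 ⟨
    (1+x · x^ 1 −1) [x^ p ]         ≈⟨ [x^]-· 1≤p 1+x (x^ 1 −1) ⟩
    1+x [x^ p ] · x^ 1 −1 [x^ p ]   ≈⟨ ·-cong ≈-refl ([x^]-x^1−1 1≤p) ⟩
    1+x [x^ p ] · x^ p −1           ∎
  x^6p−1 : 1−x+x² [x^ p ] · 1+x [x^ p ] · x^ 3 −1 [x^ p ] ≈ x^ (3 * p * 2) −1
  x^6p−1 = begin
    1−x+x² [x^ p ] · 1+x [x^ p ] · x^ 3 −1 [x^ p ]   ≈⟨ ·-cong ([x^]-· 1≤p 1−x+x² 1+x) ≈-refl ⟨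
    (1−x+x² · 1+x) [x^ p ] · x^ 3 −1 [x^ p ]         ≈⟨ [x^]-· 1≤p (1−x+x² · 1+x) (x^ 3 −1) ⟨
    (1−x+x² · 1+x · x^ 3 −1) [x^ p ]
      ≈⟨ [x^]-cong 1≤p (≈-trans (·-cong [1−x+x²][1+x]≈1+x³ ≈-refl) [1+x³][x³−1]≈x⁶−1) ⟩
    x^ 6 −1 [x^ p ]                                  ≈⟨ [x^]-x^−1 1≤p 6 ⟩
    x^ (6 * p) −1                                    ≈⟨ x^−1-cong (6*p≡3*p*2 p) ⟩
    x^ (3 * p * 2) −1                                ∎
    where
    6*p≡3*p*2 : ∀ p → 6 * p ≡ 3 * p * 2
    6*p≡3*p*2 = ℕ-Ring.solve-∀

1/[1−x+x²]-periodic : ∀ k t → 1/[1−x+x²] (k * 6 + t) ≡ 1/[1−x+x²] t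
1/[1−x+x²]-periodic zero    t = refl
1/[1−x+x²]-periodic (suc k) t = trans (cong 1/[1−x+x²] (ℕ.+-assoc 6 (k * 6) t)) (1/[1−x+x²]-periodic k t)

1/[1−x+x²]-relation₁ : ∀ u → 1/[1−x+x²] (2 + u) ℤ.- 1/[1−x+x²] (1 + u) ℤ.+ 1/[1−x+x²] u ≡ + 0
1/[1−x+x²]-relation₁ 0 = refl
1/[1−x+x²]-relation₁ 1 = refl
1/[1−x+x²]-relation₁ 2 = refl
1/[1−x+x²]-relation₁ 3 = refl
1/[1−x+x²]-relation₁ 4 = refl
1/[1−x+x²]-relation₁ 5 = refl
1/[1−x+x²]-relation₁ (suc (suc (suc (suc (suc (suc u)))))) = 1/[1−x+x²]-relation₁ u

1/[1−x+x²]-relation₅ : ∀ u → 1/[1−x+x²] (4 + u) ℤ.- 1/[1−x+x²] (5 + u) ℤ.+ 1/[1−x+x²] u ≡ + 0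
1/[1−x+x²]-relation₅ 0 = refl
1/[1−x+x²]-relation₅ 1 = refl
1/[1−x+x²]-relation₅ 2 = refl
1/[1−x+x²]-relation₅ 3 = refl
1/[1−x+x²]-relation₅ 4 = refl
1/[1−x+x²]-relation₅ 5 = refl
1/[1−x+x²]-relation₅ (suc (suc (suc (suc (suc (suc u)))))) = 1/[1−x+x²]-relation₅ u

[1−x+x²][xᵖ]·f-coeff : ∀ {p} → 1 ≤ p → ∀ f u → (1−x+x² [x^ p ] · f) (2 * p + u) ≡ f (2 * p + u) ℤ.- f (p + u) ℤ.+ f u
[1−x+x²][xᵖ]·f-coeff {p} 1≤p f u with between-multiples 1≤p (2 * p + u)
... | b , lo , hi = begin
  (1−x+x² [x^ p ] · f) (2 * p + u)
    ≡⟨ [x^]-·-coeff 1≤p {b} lo hi 1−x+x² f ⟩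
  ∑ (suc b) (λ a → 1−x+x² a ℤ.* f (2 * p + u ∸ a * p))
    ≡⟨ ∑-truncate _ (s≤s 2≤b) (λ a 3≤a _ → cong (ℤ._* f (2 * p + u ∸ a * p)) (1−x+x²-vanishes 3≤a)) ⟩
  + 1 ℤ.* f (2 * p + u) ℤ.+ (- + 1 ℤ.* f (2 * p + u ∸ 1 * p) ℤ.+ (+ 1 ℤ.* f (2 * p + u ∸ 2 * p) ℤ.+ + 0))
    ≡⟨ cong₂ (λ x y → + 1 ℤ.* f (2 * p + u) ℤ.+ (- + 1 ℤ.* f x ℤ.+ (+ 1 ℤ.* f y ℤ.+ + 0)))
             (trans (cong (_∸ 1 * p) (split-p p u)) (ℕ.m+n∸m≡n (1 * p) (p + u))) (ℕ.m+n∸m≡n (2 * p) u) ⟩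
  + 1 ℤ.* f (2 * p + u) ℤ.+ (- + 1 ℤ.* f (p + u) ℤ.+ (+ 1 ℤ.* f u ℤ.+ + 0))
    ≡⟨ simplify (f (2 * p + u)) (f (p + u)) (f u) ⟩
  f (2 * p + u) ℤ.- f (p + u) ℤ.+ f u ∎
  where
  open ≡-Reasoning
  2≤b : 2 ≤ b
  2≤b = ℕ.≤-pred (ℕ.*-cancelʳ-< p 2 (suc b) (ℕ.≤-<-trans (ℕ.m≤m+n (2 * p) u) hi))
  split-p : ∀ p u → 2 * p + u ≡ 1 * p + (p + u)
  split-p = ℕ-Ring.solve-∀
  simplify : ∀ a b c → + 1 ℤ.* a ℤ.+ (- + 1 ℤ.* b ℤ.+ (+ 1 ℤ.* c ℤ.+ + 0)) ≡ a ℤ.- b ℤ.+ c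
  simplify = solve-∀

prime⇒∤ : ∀ {p d} → Prime p → 1 < d → d < p → ¬ d ∣ p
prime⇒∤ pp 1<d d<p d∣p = prime⇒¬composite pp (hasNonTrivialDivisor {{ℕ.n>1⇒nonTrivial 1<d}} d<p d∣p)

_≡±1[mod6] : ℕ → Set
p ≡±1[mod6] = (∃[ w ] p ≡ w * 6 + 1) ⊎ (∃[ w ] p ≡ w * 6 + 5)

prime>3⇒≡±1[mod6] : ∀ {p} → Prime p → 3 < p → p ≡±1[mod6]
prime>3⇒≡±1[mod6] {p} pp 3<p = by-residue (p % 6) (m%n<n p 6) (m≡m%n+[m/n]*n p 6)
  where
  w = p / 6
  2∤p : ¬ 2 ∣ p
  2∤p = prime⇒∤ pp (s≤s (s≤s z≤n)) (ℕ.<-trans (ℕ.n<1+n 2) 3<p)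
  3∤p : ¬ 3 ∣ p
  3∤p = prime⇒∤ pp (s≤s (s≤s z≤n)) 3<p
  even₀ : ∀ w → 0 + w * 6 ≡ w * 3 * 2
  even₀ = ℕ-Ring.solve-∀
  even₂ : ∀ w → 2 + w * 6 ≡ (w * 3 + 1) * 2
  even₂ = ℕ-Ring.solve-∀
  triple₃ : ∀ w → 3 + w * 6 ≡ (w * 2 + 1) * 3
  triple₃ = ℕ-Ring.solve-∀
  even₄ : ∀ w → 4 + w * 6 ≡ (w * 3 + 2) * 2
  even₄ = ℕ-Ring.solve-∀
  by-residue : ∀ ρ → ρ < 6 → p ≡ ρ + w * 6 → p ≡±1[mod6]
  by-residue 0 _ p≡ = contradiction (divides (w * 3) (trans p≡ (even₀ w))) 2∤p
  by-residue 1 _ p≡ = inj₁ (w , trans p≡ (ℕ.+-comm 1 _))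
  by-residue 2 _ p≡ = contradiction (divides (w * 3 + 1) (trans p≡ (even₂ w))) 2∤p
  by-residue 3 _ p≡ = contradiction (divides (w * 2 + 1) (trans p≡ (triple₃ w))) 3∤p
  by-residue 4 _ p≡ = contradiction (divides (w * 3 + 2) (trans p≡ (even₄ w))) 2∤p
  by-residue 5 _ p≡ = inj₂ (w , trans p≡ (ℕ.+-comm 5 _))
  by-residue (suc (suc (suc (suc (suc (suc _)))))) (s≤s (s≤s (s≤s (s≤s (s≤s (s≤s ())))))) _

[1−x+x²][xᵖ]/[1−x+x²]-vanishes : ∀ {p} → p ≡±1[mod6] →
  ∀ {s} → 2 * p ≤ s → (1−x+x² [x^ p ] · 1/[1−x+x²]) s ≡ + 0
[1−x+x²][xᵖ]/[1−x+x²]-vanishes {p} p≡±1 {s} 2p≤s = begin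
  (1−x+x² [x^ p ] · J) s                     ≡⟨ cong (1−x+x² [x^ p ] · J) (ℕ.m+[n∸m]≡n 2p≤s) ⟨
  (1−x+x² [x^ p ] · J) (2 * p + u)           ≡⟨ [1−x+x²][xᵖ]·f-coeff (1≤p p≡±1) J u ⟩
  J (2 * p + u) ℤ.- J (p + u) ℤ.+ J u        ≡⟨ relation p≡±1 ⟩
  + 0                                        ∎
  where
  open ≡-Reasoning
  J = 1/[1−x+x²]
  u = s ∸ 2 * p
  1≤p : p ≡±1[mod6] → 1 ≤ p
  1≤p (inj₁ (w , refl)) = subst (1 ≤_) (ℕ.+-comm 1 (w * 6)) (s≤s z≤n)
  1≤p (inj₂ (w , refl)) = subst (1 ≤_) (ℕ.+-comm 5 (w * 6)) (s≤s z≤n)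
  relation : p ≡±1[mod6] → J (2 * p + u) ℤ.- J (p + u) ℤ.+ J u ≡ + 0
  relation (inj₁ (w , refl)) = begin
    J (2 * p + u) ℤ.- J (p + u) ℤ.+ J u
      ≡⟨ cong₂ (λ x y → J x ℤ.- J y ℤ.+ J u) (regroup₁ w u) (ℕ.+-assoc (w * 6) 1 u) ⟩
    J (w * 2 * 6 + (2 + u)) ℤ.- J (w * 6 + (1 + u)) ℤ.+ J u
      ≡⟨ cong₂ (λ x y → x ℤ.- y ℤ.+ J u) (1/[1−x+x²]-periodic (w * 2) (2 + u)) (1/[1−x+x²]-periodic w (1 + u)) ⟩
    J (2 + u) ℤ.- J (1 + u) ℤ.+ J u
      ≡⟨ 1/[1−x+x²]-relation₁ u ⟩
    + 0 ∎
    where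
    regroup₁ : ∀ w u → 2 * (w * 6 + 1) + u ≡ w * 2 * 6 + (2 + u)
    regroup₁ = ℕ-Ring.solve-∀
  relation (inj₂ (w , refl)) = begin
    J (2 * p + u) ℤ.- J (p + u) ℤ.+ J u
      ≡⟨ cong₂ (λ x y → J x ℤ.- J y ℤ.+ J u) (regroup₅ w u) (ℕ.+-assoc (w * 6) 5 u) ⟩
    J ((w * 2 + 1) * 6 + (4 + u)) ℤ.- J (w * 6 + (5 + u)) ℤ.+ J u
      ≡⟨ cong₂ (λ x y → x ℤ.- y ℤ.+ J u) (1/[1−x+x²]-periodic (w * 2 + 1) (4 + u)) (1/[1−x+x²]-periodic w (5 + u)) ⟩
    J (4 + u) ℤ.- J (5 + u) ℤ.+ J u
      ≡⟨ 1/[1−x+x²]-relation₅ u ⟩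
    + 0 ∎
    where
    regroup₅ : ∀ w u → 2 * (w * 6 + 5) + u ≡ (w * 2 + 1) * 6 + (4 + u)
    regroup₅ = ℕ-Ring.solve-∀

prime-3 : Prime 3
prime-3 = from-yes (prime? 3)

module _ {Φ : ℕ → Series} (cyc : IsCyclotomicFamily Φ) {p : ℕ} (pp : Prime p) (3<p : 3 < p) where

  private
    1≤p : 1 ≤ p
    1≤p = ℕ.<⇒≤ (ℕ.≤-<-trans (s≤s z≤n) 3<p)
    ∏Φ : List ℕ → Series
    ∏Φ ds = ∏ (map Φ ds)

  Φ₃ₚ-relation : Φ (3 * p) · x^ 3 −1 · x^ p −1 ≈ x^ (3 * p) −1 · x^ 1 −1
  Φ₃ₚ-relation = begin
    Φ (3 * p) · x^ 3 −1 · x^ p −1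
      ≈⟨ ·-cong (·-cong ≈-refl (≈-sym (cyclotomic-product cyc (s≤s z≤n) (divisorList-prime prime-3))))
                (≈-sym (cyclotomic-product cyc 1≤p (divisorList-prime pp))) ⟩
    Φ (3 * p) · ∏Φ (1 ∷ 3 ∷ []) · ∏Φ (1 ∷ p ∷ [])
      ≈⟨ solve 4 (λ φ₁ φ₃ φₚ φ₃ₚ → (φ₃ₚ ⊕ (φ₁ ⊕ φ₃ ⊕ ι)) ⊕ (φ₁ ⊕ φₚ ⊕ ι) ⊜ (φ₁ ⊕ φ₃ ⊕ φₚ ⊕ φ₃ₚ ⊕ ι) ⊕ (φ₁ ⊕ ι))
               ≈-refl (Φ 1) (Φ 3) (Φ p) (Φ (3 * p)) ⟩
    ∏Φ (1 ∷ 3 ∷ p ∷ 3 * p ∷ []) · ∏Φ (1 ∷ [])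
      ≈⟨ ·-cong (cyclotomic-product cyc (ℕ.≤-trans 1≤p (ℕ.m≤m+n p _)) D3p) (cyclotomic-product cyc (s≤s z≤n) divisorList-1) ⟩
    x^ (3 * p) −1 · x^ 1 −1 ∎
    where
    open ≈-Reasoning
    D3p = divisorList-*-prime₁ pp (s≤s z≤n) 3<p (divisorList-prime prime-3)

  Φ₃ₚ[xʳ]-relation : ∀ {r} → 1 ≤ r →
    Φ (3 * p) [x^ r ] · x^ (3 * r) −1 · x^ (p * r) −1 ≈ x^ (3 * p * r) −1 · x^ r −1
  Φ₃ₚ[xʳ]-relation {r} 1≤r = begin
    Φ (3 * p) [x^ r ] · x^ (3 * r) −1 · x^ (p * r) −1
      ≈⟨ ·-cong (·-cong ≈-refl ([x^]-x^−1 1≤r 3)) ([x^]-x^−1 1≤r p) ⟨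
    Φ (3 * p) [x^ r ] · x^ 3 −1 [x^ r ] · x^ p −1 [x^ r ]
      ≈⟨ ·-cong ([x^]-· 1≤r (Φ (3 * p)) (x^ 3 −1)) ≈-refl ⟨
    (Φ (3 * p) · x^ 3 −1) [x^ r ] · x^ p −1 [x^ r ]
      ≈⟨ [x^]-· 1≤r (Φ (3 * p) · x^ 3 −1) (x^ p −1) ⟨
    (Φ (3 * p) · x^ 3 −1 · x^ p −1) [x^ r ]
      ≈⟨ [x^]-cong 1≤r Φ₃ₚ-relation ⟩
    (x^ (3 * p) −1 · x^ 1 −1) [x^ r ]
      ≈⟨ [x^]-· 1≤r (x^ (3 * p) −1) (x^ 1 −1) ⟩
    x^ (3 * p) −1 [x^ r ] · x^ 1 −1 [x^ r ]
      ≈⟨ ·-cong ([x^]-x^−1 1≤r (3 * p)) ([x^]-x^1−1 1≤r) ⟩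
    x^ (3 * p * r) −1 · x^ r −1 ∎
    where open ≈-Reasoning

  Φ₃ₚ[xʳ]/Φ₃ₚ-solves : ∀ {r} → 1 ≤ r → Φ₃ₚᵣ-Equation p r (Φ (3 * p) [x^ r ] · 1/Φ₃ₚ p)
  Φ₃ₚ[xʳ]/Φ₃ₚ-solves {r} 1≤r = begin
    Φ (3 * p) [x^ r ] · 1/Φ₃ₚ p · x^ (3 * p) −1 · x^ (3 * r) −1 · x^ (p * r) −1 · x^ 1 −1
      ≈⟨ solve 6 (λ s h a b c d → ((((s ⊕ h) ⊕ a) ⊕ b) ⊕ c) ⊕ d ⊜ ((s ⊕ b) ⊕ c) ⊕ ((h ⊕ a) ⊕ d))
               ≈-refl (Φ (3 * p) [x^ r ]) (1/Φ₃ₚ p) (x^ (3 * p) −1) (x^ (3 * r) −1) (x^ (p * r) −1) (x^ 1 −1) ⟩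
    (Φ (3 * p) [x^ r ] · x^ (3 * r) −1 · x^ (p * r) −1) · (1/Φ₃ₚ p · x^ (3 * p) −1 · x^ 1 −1)
      ≈⟨ ·-cong (Φ₃ₚ[xʳ]-relation 1≤r) ([1/Φ₃ₚ][x³ᵖ−1][x−1]≈[x³−1][xᵖ−1] 1≤p) ⟩
    (x^ (3 * p * r) −1 · x^ r −1) · (x^ 3 −1 · x^ p −1)
      ≈⟨ solve 4 (λ a b c d → (a ⊕ b) ⊕ (c ⊕ d) ⊜ ((a ⊕ c) ⊕ d) ⊕ b)
               ≈-refl (x^ (3 * p * r) −1) (x^ r −1) (x^ 3 −1) (x^ p −1) ⟩
    x^ (3 * p * r) −1 · x^ 3 −1 · x^ p −1 · x^ r −1 ∎
    where open ≈-Reasoning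

  module _ {r : ℕ} (pr : Prime r) (3p<r : 3 * p < r) where

    private
      p<r : p < r
      p<r = ℕ.≤-<-trans (ℕ.m≤n*m p 3) 3p<r
      3<r : 3 < r
      3<r = ℕ.<-trans 3<p p<r
      1≤r : 1 ≤ r
      1≤r = ℕ.<⇒≤ (ℕ.≤-<-trans (s≤s z≤n) 3<r)

    Φ₃ₚᵣ-solves : Φ₃ₚᵣ-Equation p r (Φ (3 * p * r))
    Φ₃ₚᵣ-solves = begin
      Φ (3 * p * r) · x^ (3 * p) −1 · x^ (3 * r) −1 · x^ (p * r) −1 · x^ 1 −1
        ≈⟨ ·-cong (·-cong (·-cong (·-cong ≈-refl X3p) X3r) Xpr) X1 ⟨
      Φ (3 * p * r) · ∏Φ (1 ∷ 3 ∷ p ∷ 3 * p ∷ []) · ∏Φ (1 ∷ 3 ∷ r ∷ 3 * r ∷ []) · ∏Φ (1 ∷ p ∷ r ∷ p * r ∷ []) · ∏Φ (1 ∷ [])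
        ≈⟨ solve 8 (λ φ₁ φ₃ φₚ φ₃ₚ φᵣ φ₃ᵣ φₚᵣ φ₃ₚᵣ →
                  (((φ₃ₚᵣ ⊕ (φ₁ ⊕ φ₃ ⊕ φₚ ⊕ φ₃ₚ ⊕ ι)) ⊕ (φ₁ ⊕ φ₃ ⊕ φᵣ ⊕ φ₃ᵣ ⊕ ι)) ⊕ (φ₁ ⊕ φₚ ⊕ φᵣ ⊕ φₚᵣ ⊕ ι)) ⊕ (φ₁ ⊕ ι)
                ⊜ (((φ₁ ⊕ φ₃ ⊕ φₚ ⊕ φ₃ₚ ⊕ φᵣ ⊕ φ₃ᵣ ⊕ φₚᵣ ⊕ φ₃ₚᵣ ⊕ ι) ⊕ (φ₁ ⊕ φ₃ ⊕ ι)) ⊕ (φ₁ ⊕ φₚ ⊕ ι)) ⊕ (φ₁ ⊕ φᵣ ⊕ ι))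
                ≈-refl (Φ 1) (Φ 3) (Φ p) (Φ (3 * p)) (Φ r) (Φ (3 * r)) (Φ (p * r)) (Φ (3 * p * r)) ⟩
      ∏Φ (1 ∷ 3 ∷ p ∷ 3 * p ∷ r ∷ 3 * r ∷ p * r ∷ 3 * p * r ∷ []) · ∏Φ (1 ∷ 3 ∷ []) · ∏Φ (1 ∷ p ∷ []) · ∏Φ (1 ∷ r ∷ [])
        ≈⟨ ·-cong (·-cong (·-cong X3pr X3) Xp) Xr ⟩
      x^ (3 * p * r) −1 · x^ 3 −1 · x^ p −1 · x^ r −1 ∎
      where
      open ≈-Reasoning
      1≤3p = 1≤m*n {3} (s≤s z≤n) 1≤p
      D3 = divisorList-prime prime-3
      D3p = divisorList-*-prime₁ pp (s≤s z≤n) 3<p D3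
      X1 = cyclotomic-product cyc (s≤s z≤n) divisorList-1
      X3 = cyclotomic-product cyc (s≤s z≤n) D3
      Xp = cyclotomic-product cyc 1≤p (divisorList-prime pp)
      Xr = cyclotomic-product cyc 1≤r (divisorList-prime pr)
      X3p = cyclotomic-product cyc 1≤3p D3p
      X3r = cyclotomic-product cyc (1≤m*n {3} (s≤s z≤n) 1≤r) (divisorList-*-prime₁ pr (s≤s z≤n) 3<r D3)
      Xpr = cyclotomic-product cyc (1≤m*n 1≤p 1≤r) (divisorList-*-prime₁ pr 1≤p p<r (divisorList-prime pp))
      X3pr = cyclotomic-product cyc (1≤m*n 1≤3p 1≤r) (divisorList-*-prime₁ pr 1≤3p 3p<r D3p)

    Φ₃ₚᵣ≈Φ₃ₚ[xʳ]/Φ₃ₚ : Φ (3 * p * r) ≈ Φ (3 * p) [x^ r ] · 1/Φ₃ₚ p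
    Φ₃ₚᵣ≈Φ₃ₚ[xʳ]/Φ₃ₚ = Φ₃ₚᵣ-Equation-unique 1≤p 1≤r Φ₃ₚᵣ-solves (Φ₃ₚ[xʳ]/Φ₃ₚ-solves 1≤r)

  Φ₃ₚ[x²]/Φ₃ₚ≈[1−x+x²][xᵖ]/[1−x+x²] : Φ (3 * p) [x^ 2 ] · 1/Φ₃ₚ p ≈ 1−x+x² [x^ p ] · 1/[1−x+x²]
  Φ₃ₚ[x²]/Φ₃ₚ≈[1−x+x²][xᵖ]/[1−x+x²] =
    Φ₃ₚᵣ-Equation-unique 1≤p (s≤s z≤n) (Φ₃ₚ[xʳ]/Φ₃ₚ-solves (s≤s z≤n)) ([1−x+x²][xᵖ]/[1−x+x²]-solves 1≤p)

  Φ₃ₚᵣ-coeff-vanishes : ∀ {r} → Prime r → 3 * p < r → ∀ q → r ≡ q * (3 * p) + 2 →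
    ∀ i → p ≤ i → ∀ l → l ≤ 1 → Φ (3 * p * r) (i * r + (q * (3 * p) + l)) ≡ + 0
  Φ₃ₚᵣ-coeff-vanishes {r} pr 3p<r q refl i p≤i l l≤1 = begin
    Φ (3 * p * r) N
      ≡⟨ Φ₃ₚᵣ≈Φ₃ₚ[xʳ]/Φ₃ₚ pr 3p<r .coeff N ⟩
    (Φ (3 * p) [x^ r ] · 1/Φ₃ₚ p) N
      ≡⟨ [x^]-·-coeff 1≤r {i} (ℕ.m≤m+n (i * r) _) N<[1+i]r (Φ (3 * p)) (1/Φ₃ₚ p) ⟩
    ∑ (suc i) (λ a → Φ (3 * p) a ℤ.* 1/Φ₃ₚ p (N ∸ a * r))
      ≡⟨ ∑-cong (suc i) (λ a a≤i → cong (Φ (3 * p) a ℤ.*_) (1/Φ₃ₚ-r≡2[mod3p] 2≤p q l (ℕ.≤-pred a≤i))) ⟩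
    ∑ (suc i) (λ a → Φ (3 * p) a ℤ.* 1/Φ₃ₚ p (s ∸ a * 2))
      ≡⟨ [x^]-·-coeff (s≤s z≤n) {i} (ℕ.m≤m+n (i * 2) l) s<[1+i]2 (Φ (3 * p)) (1/Φ₃ₚ p) ⟨
    (Φ (3 * p) [x^ 2 ] · 1/Φ₃ₚ p) s
      ≡⟨ Φ₃ₚ[x²]/Φ₃ₚ≈[1−x+x²][xᵖ]/[1−x+x²] .coeff s ⟩
    (1−x+x² [x^ p ] · 1/[1−x+x²]) s
      ≡⟨ [1−x+x²][xᵖ]/[1−x+x²]-vanishes (prime>3⇒≡±1[mod6] pp 3<p) 2p≤s ⟩
    + 0 ∎
    where
    open ≡-Reasoning
    N = i * r + (q * (3 * p) + l)
    s = i * 2 + l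
    1≤r = ℕ.≤-trans (s≤s z≤n) (ℕ.m≤n+m 2 (q * (3 * p)))
    2≤p = ℕ.<⇒≤ (ℕ.<-trans (ℕ.n<1+n 2) 3<p)
    N<[1+i]r : N < suc i * r
    N<[1+i]r = subst (N <_) (ℕ.+-comm (i * r) r) (ℕ.+-monoʳ-< (i * r) (ℕ.+-monoʳ-< (q * (3 * p)) (s≤s l≤1)))
    s<[1+i]2 : s < suc i * 2
    s<[1+i]2 = subst (s <_) (ℕ.+-comm (i * 2) 2) (ℕ.+-monoʳ-< (i * 2) (s≤s l≤1))
    2p≤s : 2 * p ≤ s
    2p≤s = ℕ.≤-trans (ℕ.≤-reflexive (ℕ.*-comm 2 p)) (ℕ.≤-trans (ℕ.*-monoˡ-≤ 2 p≤i) (ℕ.m≤m+n (i * 2) l))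

if-vanishes : ∀ b {x} → x ≡ + 0 → (if b then x else + 0) ≡ + 0
if-vanishes true  x≡0 = x≡0
if-vanishes false _   = refl

lemma4p6 : (Φ : ℕ → Series) → IsCyclotomicFamily Φ →
    (p₂ p₃ : ℕ) → Prime p₂ → 3 < p₂ → Prime p₃ → 3 * p₂ < p₃ →
    modℕ p₃ (3 * p₂) ≡ 2 →
    (i : ℕ) → p₂ ≤ i →
    (l : ℕ) → fSubBlock Φ (3 * p₂) p₃ i (divℕ p₃ (3 * p₂)) l ≡ + 0
-- Matching p₂ as a successor lets divℕ and modℕ compute.
lemma4p6 Φ cyc p@(suc _) r pp 3<p pr 3p<r r%3p≡2 i p≤i l = if-vanishes (does (l <? 3 * p)) (block-vanishes l)
  where
  q = divℕ r (3 * p)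
  r≡q*3p+2 : r ≡ q * (3 * p) + 2
  r≡q*3p+2 = trans (m≡m%n+[m/n]*n r (3 * p)) (trans (cong (_+ q * (3 * p)) r%3p≡2) (ℕ.+-comm 2 _))
  block-vanishes : ∀ l → fBlock Φ (3 * p) r i (q * (3 * p) + l) ≡ + 0
  block-vanishes 0 = if-vanishes _ (Φ₃ₚᵣ-coeff-vanishes cyc pp 3<p pr 3p<r q r≡q*3p+2 i p≤i 0 z≤n)
  block-vanishes 1 = if-vanishes _ (Φ₃ₚᵣ-coeff-vanishes cyc pp 3<p pr 3p<r q r≡q*3p+2 i p≤i 1 (s≤s z≤n))
  block-vanishes (suc (suc l))
    rewrite dec-false (q * (3 * p) + suc (suc l) <? r)
                      (ℕ.≤⇒≯ (subst (_≤ q * (3 * p) + suc (suc l)) (sym r≡q*3p+2) (ℕ.+-monoʳ-≤ _ (s≤s (s≤s z≤n))))) = refl
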